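{- In any ordered divisible abelian group (possibly with additional symbols in its language), if the scheme $\mathtt{DCI}$ holds then the scheme $\mathtt{DCI}_1$ holds too. The converse fails: in the ordered field of rational numbers $\mathbb{Q}$ the scheme $\mathtt{DCI}_1$ holds but $\mathtt{DCI}$ does not.
   Context: Formulas are first-order formulas in the language of the structure (which contains $<,0,+$; for $\mathbb{Q}$ it is the language of ordered fields); a scheme "holds" in a structure if every instance (with any further free variables of $\varphi$ read universally, as parameters) is true in it. The scheme $\mathtt{DCI}$ consists of all sentences $$\exists x\,\forall y\!<\!x\,\varphi(y)\;\wedge\;\forall x\big[\forall y\!<\!x\,\varphi(y)\rightarrow\exists z\!>\!x\,\forall y\!<\!z\,\varphi(y)\big]\longrightarrow\forall x\,\varphi(x).$$ The scheme $\mathtt{DCI}_1$ consists of all sentences $$\exists x\,\forall y\!\leqslant\!x\,\varphi(y)\;\wedge\;\exists\epsilon\!>\!0\,\forall x\big(\varphi(x)\rightarrow\forall y\,[x\!\leqslant\!y\!\leqslant\!x+\epsilon\rightarrow\varphi(y)]\big)\longrightarrow\forall x\,\varphi(x).$$ -}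

module Defs where

open import Level using (0ℓ)
open import Data.Nat using (ℕ; zero; suc)
open import Data.Fin using (Fin)
import Data.Fin
open import Data.Sum using (_⊎_; inj₁; inj₂)
open import Data.Product using (Σ; _×_; _,_; ∃; ∃-syntax)
open import Data.Empty using (⊥)
open import Data.Unit using (⊤)
open import Data.Vec.Functional using (_∷_)
open import Relation.Nullary using (¬_)
open import Relation.Binary.PropositionalEquality using (_≡_)
import Data.Rational as ℚ

record Signature : Set₁ where
  field
    Fun : ℕ → Set
    Rel : ℕ → Set
open Signature public

data Term (S : Signature) (n : ℕ) : Set where
  var : Fin n → Term S n
  app : ∀ {k} → Fun S k → (Fin k → Term S n) → Term S n

-- formulas with n free variables; variable 0 is the most recently bound
data Formula (S : Signature) : ℕ → Set where
  rel  : ∀ {n k} → Rel S k → (Fin k → Term S n) → Formula S n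
  _≐_  : ∀ {n} → Term S n → Term S n → Formula S n
  ⊤'   : ∀ {n} → Formula S n
  ⊥'   : ∀ {n} → Formula S n
  ¬'_  : ∀ {n} → Formula S n → Formula S n
  _∧'_ : ∀ {n} → Formula S n → Formula S n → Formula S n
  _∨'_ : ∀ {n} → Formula S n → Formula S n → Formula S n
  _⇒'_ : ∀ {n} → Formula S n → Formula S n → Formula S n
  ∀'_  : ∀ {n} → Formula S (suc n) → Formula S n
  ∃'_  : ∀ {n} → Formula S (suc n) → Formula S n

record Structure (S : Signature) : Set₁ where
  field
    Carrier : Set
    funI    : ∀ {k} → Fun S k → (Fin k → Carrier) → Carrier
    relI    : ∀ {k} → Rel S k → (Fin k → Carrier) → Set
open Structure public

module _ {S : Signature} (M : Structure S) where
  evalT : ∀ {n} → (Fin n → Carrier M) → Term S n → Carrier M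
  evalT ρ (var i)    = ρ i
  evalT ρ (app f ts) = funI M f (λ i → evalT ρ (ts i))

  -- Tarskian satisfaction (truth values are types; classical reading is
  -- obtained from the excluded-middle hypothesis of the theorem)
  Sat : ∀ {n} → Formula S n → (Fin n → Carrier M) → Set
  Sat (rel R ts) ρ = relI M R (λ i → evalT ρ (ts i))
  Sat (t ≐ u)    ρ = evalT ρ t ≡ evalT ρ u
  Sat ⊤'         ρ = ⊤
  Sat ⊥'         ρ = ⊥
  Sat (¬' φ)     ρ = ¬ Sat φ ρ
  Sat (φ ∧' ψ)   ρ = Sat φ ρ × Sat ψ ρ
  Sat (φ ∨' ψ)   ρ = Sat φ ρ ⊎ Sat ψ ρ
  Sat (φ ⇒' ψ)   ρ = Sat φ ρ → Sat ψ ρ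
  Sat (∀' φ)     ρ = (a : Carrier M) → Sat φ (a ∷ ρ)
  Sat (∃' φ)     ρ = Σ (Carrier M) (λ a → Sat φ (a ∷ ρ))

-- The two induction schemes, for a structure M whose language interprets
-- the order by _<_, zero by 0# and addition by _+_.

module Schemes {S : Signature} (M : Structure S)
               (_<_ : Carrier M → Carrier M → Set)
               (0# : Carrier M) (_+_ : Carrier M → Carrier M → Carrier M) where
  private C = Carrier M

  _≤_ : C → C → Set
  x ≤ y = (x < y) ⊎ (x ≡ y)

  DCI-inst : (C → Set) → Set
  DCI-inst φ =
    (∃[ x ] (∀ y → y < x → φ y)) ×
    (∀ x → (∀ y → y < x → φ y) → ∃[ z ] (x < z × (∀ y → y < z → φ y)))
    → ∀ x → φ x

  DCI₁-inst : (C → Set) → Set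
  DCI₁-inst φ =
    (∃[ x ] (∀ y → y ≤ x → φ y)) ×
    (∃[ ε ] (0# < ε × (∀ x → φ x → ∀ y → x ≤ y → y ≤ (x + ε) → φ y)))
    → ∀ x → φ x

  -- the scheme holds: every instance φ(y, p̄) with all parameters p̄
  DCI : Set
  DCI = ∀ {n} (φ : Formula S (suc n)) (ρ : Fin n → C) →
        DCI-inst (λ y → Sat M φ (y ∷ ρ))

  DCI₁ : Set
  DCI₁ = ∀ {n} (φ : Formula S (suc n)) (ρ : Fin n → C) →
         DCI₁-inst (λ y → Sat M φ (y ∷ ρ))

data OGFun : ℕ → Set where
  zeroF : OGFun 0
  plusF : OGFun 2

data OGRel : ℕ → Set where
  lessR : OGRel 2

OGSig : Signature → Signature
OGSig E = record { Fun = λ k → OGFun k ⊎ Fun E k ; Rel = λ k → OGRel k ⊎ Rel E k }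

times : {A : Set} → (A → A → A) → A → ℕ → A → A
times _+_ 0# zero    y = 0#
times _+_ 0# (suc n) y = y + times _+_ 0# n y

record ODAG (E : Signature) : Set₁ where
  infixl 6 _+_
  infix 4 _<_
  field
    Carrier  : Set
    _+_      : Carrier → Carrier → Carrier
    0#       : Carrier
    _<_      : Carrier → Carrier → Set
    extraFun : ∀ {k} → Fun E k → (Fin k → Carrier) → Carrier
    extraRel : ∀ {k} → Rel E k → (Fin k → Carrier) → Set
    +-assoc   : ∀ x y z → (x + y) + z ≡ x + (y + z)
    +-comm    : ∀ x y → x + y ≡ y + x
    +-idʳ     : ∀ x → x + 0# ≡ x
    +-inv     : ∀ x → ∃[ y ] (x + y ≡ 0#)
    <-irrefl  : ∀ x → ¬ (x < x)
    <-trans   : ∀ x y z → x < y → y < z → x < z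
    <-trichot : ∀ x y → (x < y) ⊎ (x ≡ y) ⊎ (y < x)
    <-+       : ∀ x y z → x < y → x + z < y + z
    divisible : ∀ (n : ℕ) x → ∃[ y ] (times _+_ 0# (suc n) y ≡ x)

ODAG-Structure : ∀ {E} → ODAG E → Structure (OGSig E)
ODAG-Structure {E} G = record
  { Carrier = ODAG.Carrier G
  ; funI = fI
  ; relI = rI
  }
  where
    open ODAG G renaming (Carrier to G₀)
    fI : ∀ {k} → OGFun k ⊎ Fun E k → (Fin k → G₀) → G₀
    fI (inj₁ zeroF) a = 0#
    fI (inj₁ plusF) a = a Data.Fin.zero + a (Data.Fin.suc Data.Fin.zero)
    fI (inj₂ f)     a = extraFun f a
    rI : ∀ {k} → OGRel k ⊎ Rel E k → (Fin k → G₀) → Set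
    rI (inj₁ lessR) a = a Data.Fin.zero < a (Data.Fin.suc Data.Fin.zero)
    rI (inj₂ R)     a = extraRel R a

DCI-ODAG : ∀ {E} → ODAG E → Set
DCI-ODAG G = Schemes.DCI (ODAG-Structure G) (ODAG._<_ G) (ODAG.0# G) (ODAG._+_ G)

DCI₁-ODAG : ∀ {E} → ODAG E → Set
DCI₁-ODAG G = Schemes.DCI₁ (ODAG-Structure G) (ODAG._<_ G) (ODAG.0# G) (ODAG._+_ G)

data OFFun : ℕ → Set where
  zeroF oneF : OFFun 0
  negF       : OFFun 1
  plusF mulF : OFFun 2

data OFRel : ℕ → Set where
  lessR : OFRel 2

OFSig : Signature
OFSig = record { Fun = OFFun ; Rel = OFRel }

ℚ-Structure : Structure OFSig
ℚ-Structure = record { Carrier = ℚ.ℚ ; funI = fI ; relI = rI }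
  where
    fI : ∀ {k} → OFFun k → (Fin k → ℚ.ℚ) → ℚ.ℚ
    fI zeroF a = ℚ.0ℚ
    fI oneF  a = ℚ.1ℚ
    fI negF  a = ℚ.- a Data.Fin.zero
    fI plusF a = a Data.Fin.zero ℚ.+ a (Data.Fin.suc Data.Fin.zero)
    fI mulF  a = a Data.Fin.zero ℚ.* a (Data.Fin.suc Data.Fin.zero)
    rI : ∀ {k} → OFRel k → (Fin k → ℚ.ℚ) → Set
    rI lessR a = a Data.Fin.zero ℚ.< a (Data.Fin.suc Data.Fin.zero)

DCI-ℚ : Set
DCI-ℚ = Schemes.DCI ℚ-Structure ℚ._<_ ℚ.0ℚ ℚ._+_

DCI₁-ℚ : Set
DCI₁-ℚ = Schemes.DCI₁ ℚ-Structure ℚ._<_ ℚ.0ℚ ℚ._+_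

-- The three parts of the theorem are proved for arbitrary predicates.
--
-- 1. DCI ⇒ DCI₁ (any ODAG).  Given a DCI₁ hypothesis with step ε, halve
--    ε = δ + δ.  If φ holds below x, then φ holds at w = x - δ and hence,
--    by the ε-closure, on [w, w + ε] = [x - δ, x + δ]; so φ holds below
--    z = x + δ > x, which is the DCI step.
-- 2. DCI₁ holds in ℚ.  ℚ is Archimedean: every x lies below a + k·ε for
--    some natural k, and induction on k propagates φ from (-∞, a] along
--    the intervals [a + k·ε, a + (k+1)·ε].
-- 3. DCI fails in ℚ for φ(y) ≡ y < 0 ∨ y·y < 1 + 1.  The map
--    x ↦ (2x + 2)/(x + 2) sends a positive x with x² < 2 to a larger one
--    with the same property, and one with x² > 2 to a smaller one; since
--    x² = 2 has no rational solution, the DCI hypotheses hold, yet φ(2)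
--    is false.

module Submission where

open import Defs
open import Level using (0ℓ)
open import Data.Nat using (ℕ; zero; suc)
open import Data.Product using (_×_; _,_; ∃-syntax; proj₁; proj₂)
open import Data.Sum using (_⊎_; inj₁; inj₂)
open import Data.Empty using (⊥; ⊥-elim)
open import Data.Unit using (tt)
open import Relation.Nullary using (¬_; yes; no)
open import Relation.Binary.PropositionalEquality
open import Axiom.ExcludedMiddle using (ExcludedMiddle)

module DCI⇒DCI₁ {E : Signature} (G : ODAG E) where
  open ODAG G renaming (Carrier to C)
  open Schemes (ODAG-Structure G) _<_ 0# _+_ using (DCI-inst; DCI₁-inst)

  +-idˡ : ∀ x → 0# + x ≡ x
  +-idˡ x = trans (+-comm 0# x) (+-idʳ x)

  -_ : C → C
  - x = proj₁ (+-inv x)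

  +-invʳ : ∀ x → x + (- x) ≡ 0#
  +-invʳ x = proj₂ (+-inv x)

  <-+pos : ∀ x {d} → 0# < d → x < x + d
  <-+pos x {d} 0<d = subst₂ _<_ (+-idˡ x) (+-comm d x) (<-+ 0# d x 0<d)

  -+pos< : ∀ x {d} → 0# < d → x + (- d) < x
  -+pos< x {d} 0<d = subst₂ _<_ (+-idˡ (x + - d)) d+[x-d]≡x (<-+ 0# d (x + - d) 0<d)
    where
    d+[x-d]≡x : d + (x + - d) ≡ x
    d+[x-d]≡x = begin
      d + (x + - d)  ≡⟨ cong (d +_) (+-comm x (- d)) ⟩
      d + (- d + x)  ≡⟨ sym (+-assoc d (- d) x) ⟩
      (d + - d) + x  ≡⟨ cong (_+ x) (+-invʳ d) ⟩
      0# + x         ≡⟨ +-idˡ x ⟩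
      x              ∎
      where open ≡-Reasoning

  halve : ∀ ε → 0# < ε → ∃[ δ ] (0# < δ × δ + δ ≡ ε)
  halve ε 0<ε = δ , 0<δ , δ+δ≡ε
    where
    δ : C
    δ = proj₁ (divisible 1 ε)
    δ+δ≡ε : δ + δ ≡ ε
    δ+δ≡ε = trans (cong (δ +_) (sym (+-idʳ δ))) (proj₂ (divisible 1 ε))
    0<δ : 0# < δ
    0<δ with <-trichot 0# δ
    ... | inj₁ 0<δ = 0<δ
    ... | inj₂ (inj₁ 0≡δ) =
      ⊥-elim (<-irrefl 0# (subst (0# <_) (trans (sym δ+δ≡ε) (trans (cong₂ _+_ (sym 0≡δ) (sym 0≡δ)) (+-idʳ 0#))) 0<ε))
    ... | inj₂ (inj₂ δ<0) = ⊥-elim (<-irrefl 0# (<-trans 0# ε 0# 0<ε ε<0))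
      where
      ε<0 : ε < 0#
      ε<0 = subst (_< 0#) δ+δ≡ε
              (<-trans (δ + δ) δ 0# (subst (δ + δ <_) (+-idˡ δ) (<-+ δ 0# δ δ<0)) δ<0)

  recentre : ∀ x δ → (x + - δ) + (δ + δ) ≡ x + δ
  recentre x δ = begin
    (x + - δ) + (δ + δ)  ≡⟨ +-assoc x (- δ) (δ + δ) ⟩
    x + (- δ + (δ + δ))  ≡⟨ cong (x +_) (sym (+-assoc (- δ) δ δ)) ⟩
    x + ((- δ + δ) + δ)  ≡⟨ cong (λ u → x + (u + δ)) (trans (+-comm (- δ) δ) (+-invʳ δ)) ⟩
    x + (0# + δ)         ≡⟨ cong (x +_) (+-idˡ δ) ⟩
    x + δ                ∎
    where open ≡-Reasoning

  glue-below : (P : C → Set) {w x z : C} → w < x →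
               (∀ y → y < x → P y) → (∀ y → w < y → y < z → P y) →
               ∀ y → y < z → P y
  glue-below P {w} {x} w<x below-x on-wz y y<z with <-trichot y x
  ... | inj₁ y<x = below-x y y<x
  ... | inj₂ (inj₁ refl) = on-wz y w<x y<z
  ... | inj₂ (inj₂ x<y) = on-wz y (<-trans w x y w<x x<y) y<z

  dci⇒dci₁ : (P : C → Set) → DCI-inst P → DCI₁-inst P
  dci⇒dci₁ P dci ((x₀ , P≤x₀) , (ε , 0<ε , ε-closed)) =
    dci ((x₀ , λ y y<x₀ → P≤x₀ y (inj₁ y<x₀)) , step)
    where
    δ : C
    δ = proj₁ (halve ε 0<ε)
    0<δ : 0# < δ
    0<δ = proj₁ (proj₂ (halve ε 0<ε))
    δ+δ≡ε : δ + δ ≡ ε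
    δ+δ≡ε = proj₂ (proj₂ (halve ε 0<ε))

    step : ∀ x → (∀ y → y < x → P y) → ∃[ z ] (x < z × (∀ y → y < z → P y))
    step x below-x = x + δ , <-+pos x 0<δ , glue-below P w<x below-x on-window
      where
      w : C
      w = x + - δ
      w<x : w < x
      w<x = -+pos< x 0<δ
      w+ε≡x+δ : w + ε ≡ x + δ
      w+ε≡x+δ = trans (cong (w +_) (sym δ+δ≡ε)) (recentre x δ)
      on-window : ∀ y → w < y → y < x + δ → P y
      on-window y w<y y<z =
        ε-closed w (below-x w w<x) y (inj₁ w<y) (inj₁ (subst (y <_) (sym w+ε≡x+δ) y<z))

  dci⇒dci₁-ODAG : DCI-ODAG G → DCI₁-ODAG G
  dci⇒dci₁-ODAG dci φ ρ = dci⇒dci₁ _ (dci φ ρ)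

module ℚ-DCI₁ where
  import Data.Integer as ℤ
  import Data.Integer.Properties as ℤ
  import Data.Nat.Properties as ℕ
  import Data.Rational.Unnormalised as ℚᵘ
  import Data.Rational.Unnormalised.Properties as ℚᵘ
  open import Data.Rational
  open import Data.Rational.Properties
  open import Data.Rational.Literals using (fromℤ)
  open import Data.Rational.Solver using (module +-*-Solver)
  open +-*-Solver
  open import Relation.Binary using (tri<; tri≈; tri>)
  module S = Schemes ℚ-Structure _<_ 0ℚ _+_

  [_]ℚ : ℕ → ℚ
  [ k ]ℚ = fromℤ (ℤ.+ k)

  [suc]ℚ : ∀ k → [ suc k ]ℚ ≡ 1ℚ + [ k ]ℚ
  [suc]ℚ k = toℚᵘ-injective (ℚᵘ.≃-sym (ℚᵘ.≃-trans (toℚᵘ-homo-+ 1ℚ [ k ]ℚ) (ℚᵘ.*≡* cross)))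
    where
    cross : (ℤ.+ 1 ℤ.* ℤ.+ 1 ℤ.+ ℤ.+ k ℤ.* ℤ.+ 1) ℤ.* ℤ.+ 1 ≡ ℤ.+ suc k ℤ.* ℤ.+ 1
    cross = trans (ℤ.*-identityʳ _)
              (trans (cong (ℤ._+_ (ℤ.+ 1)) (ℤ.*-identityʳ (ℤ.+ k))) (sym (ℤ.*-identityʳ _)))

  ≤-[∣numerator∣]ℚ : ∀ t → t ≤ [ ℤ.∣ ↥ t ∣ ]ℚ
  ≤-[∣numerator∣]ℚ (mkℚ (ℤ.+ n) d _) =
    *≤* (subst₂ ℤ._≤_ (sym (ℤ.*-identityʳ (ℤ.+ n))) (ℤ.pos-* n (suc d)) (ℤ.+≤+ (ℕ.m≤m*n n (suc d))))
  ≤-[∣numerator∣]ℚ (mkℚ ℤ.-[1+ n ] d _) =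
    *≤* (ℤ.≤-trans (ℤ.≤-reflexive (ℤ.*-identityʳ ℤ.-[1+ n ])) ℤ.-≤+)

  archimedean : ∀ a x ε → 0ℚ < ε → ∃[ k ] (x ≤ a + [ k ]ℚ * ε)
  archimedean a x ε 0<ε = ℤ.∣ ↥ w ∣ , subst (_≤ a + [ ℤ.∣ ↥ w ∣ ]ℚ * ε) a+w*ε≡x
    (+-monoʳ-≤ a (*-monoʳ-≤-nonNeg ε {{pos⇒nonNeg ε {{positive 0<ε}}}} (≤-[∣numerator∣]ℚ w)))
    where
    instance
      ε≢0 : NonZero ε
      ε≢0 = >-nonZero 0<ε
    w : ℚ
    w = (x - a) * 1/ ε
    a+w*ε≡x : a + w * ε ≡ x
    a+w*ε≡x = begin
      a + (x - a) * 1/ ε * ε    ≡⟨ solve 4 (λ a x i e → a :+ (x :- a) :* i :* e := a :+ (x :- a) :* (i :* e)) refl a x (1/ ε) ε ⟩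
      a + (x - a) * (1/ ε * ε)  ≡⟨ cong (λ u → a + (x - a) * u) (*-inverseˡ ε) ⟩
      a + (x - a) * 1ℚ          ≡⟨ solve 2 (λ a x → a :+ (x :- a) :* con 1ℚ := x) refl a x ⟩
      x                         ∎
      where open ≡-Reasoning

  ≤⇒≤ₛ : ∀ {p q} → p ≤ q → p S.≤ q
  ≤⇒≤ₛ {p} {q} p≤q with <-cmp p q
  ... | tri< p<q _ _ = inj₁ p<q
  ... | tri≈ _ p≡q _ = inj₂ p≡q
  ... | tri> _ _ q<p = ⊥-elim (<-irrefl refl (≤-<-trans p≤q q<p))

  ε-Closed : (ℚ → Set) → ℚ → Set
  ε-Closed P ε = ∀ x → P x → ∀ y → x S.≤ y → y S.≤ (x + ε) → P y

  ε-steps : (P : ℚ → Set) {a ε : ℚ} → (∀ y → y S.≤ a → P y) → ε-Closed P ε →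
            ∀ k y → y ≤ a + [ k ]ℚ * ε → P y
  ε-steps P {a} {ε} P≤a closed zero y y≤a+0 =
    P≤a y (≤⇒≤ₛ (subst (y ≤_) (trans (cong (a +_) (*-zeroˡ ε)) (+-identityʳ a)) y≤a+0))
  ε-steps P {a} {ε} P≤a closed (suc k) y y≤a+[k+1]ε with y ≤? a + [ k ]ℚ * ε
  ... | yes y≤s = ε-steps P P≤a closed k y y≤s
  ... | no y≰s = closed s (ε-steps P P≤a closed k s ≤-refl) y (inj₁ (≰⇒> y≰s))
                   (≤⇒≤ₛ (subst (y ≤_) next y≤a+[k+1]ε))
    where
    s : ℚ
    s = a + [ k ]ℚ * ε
    next : a + [ suc k ]ℚ * ε ≡ s + ε
    next = trans (cong (λ u → a + u * ε) ([suc]ℚ k))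
             (solve 3 (λ a n e → a :+ (con 1ℚ :+ n) :* e := (a :+ n :* e) :+ e) refl a [ k ]ℚ ε)

  dci₁-inst : (P : ℚ → Set) → S.DCI₁-inst P
  dci₁-inst P ((a , P≤a) , (ε , 0<ε , closed)) x =
    ε-steps P P≤a closed (proj₁ (archimedean a x ε 0<ε)) x (proj₂ (archimedean a x ε 0<ε))

  dci₁-ℚ : DCI₁-ℚ
  dci₁-ℚ φ ρ = dci₁-inst _

module Irrationality where
  import Data.Nat as ℕ
  import Data.Nat.Properties as ℕ
  open import Data.Nat.Divisibility using (_∣_; divides)
  open import Data.Nat.Primality using (prime?; euclidsLemma)
  open import Data.Nat.Coprimality using (Coprime; recompute)
  open import Data.Nat.Solver using (module +-*-Solver)
  open +-*-Solver
  open import Relation.Nullary.Decidable using (from-yes)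
  import Data.Integer as ℤ
  import Data.Integer.Properties as ℤ
  import Data.Rational.Unnormalised as ℚᵘ
  import Data.Rational.Unnormalised.Properties as ℚᵘ
  open import Data.Rational using (mkℚ; _*_; _+_; 1ℚ; toℚᵘ)
  open import Data.Rational.Properties using (toℚᵘ-homo-*)

  2∣²⇒2∣ : ∀ a → 2 ∣ a ℕ.* a → 2 ∣ a
  2∣²⇒2∣ a 2∣a² with euclidsLemma a a (from-yes (prime? 2)) 2∣a²
  ... | inj₁ 2∣a = 2∣a
  ... | inj₂ 2∣a = 2∣a

  no-coprime-sqrt2 : ∀ a b → Coprime a b → a ℕ.* a ≡ 2 ℕ.* (b ℕ.* b) → ⊥
  no-coprime-sqrt2 a b coprime a²≡2b² with 2∣²⇒2∣ a (divides (b ℕ.* b) (trans a²≡2b² (ℕ.*-comm 2 (b ℕ.* b))))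
  ... | divides q refl = 2≢1 (coprime (divides q refl , 2∣b))
    where
    2≢1 : 2 ≢ 1
    2≢1 ()
    b²≡2q² : b ℕ.* b ≡ 2 ℕ.* (q ℕ.* q)
    b²≡2q² = ℕ.*-cancelˡ-≡ (b ℕ.* b) (2 ℕ.* (q ℕ.* q)) 2
      (trans (sym a²≡2b²) (solve 1 (λ q → (q :* con 2) :* (q :* con 2) := con 2 :* (con 2 :* (q :* q))) refl q))
    2∣b : 2 ∣ b
    2∣b = 2∣²⇒2∣ b (divides (q ℕ.* q) (trans b²≡2q² (ℕ.*-comm 2 (q ℕ.* q))))

  no-sqrt2 : ∀ x → x * x ≡ 1ℚ + 1ℚ → ⊥
  no-sqrt2 x@(mkℚ n d coprime) x²≡2 with ℚᵘ.≃-trans (ℚᵘ.≃-sym (toℚᵘ-homo-* x x)) (ℚᵘ.≃-reflexive (cong toℚᵘ x²≡2))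
  ... | ℚᵘ.*≡* cross = no-coprime-sqrt2 ℤ.∣ n ∣ (suc d) (recompute coprime) ∣n∣²≡2d²
    where
    ∣n∣²≡2d² : ℤ.∣ n ∣ ℕ.* ℤ.∣ n ∣ ≡ 2 ℕ.* (suc d ℕ.* suc d)
    ∣n∣²≡2d² = trans (sym (ℤ.abs-* n n))
      (trans (cong ℤ.∣_∣ (sym (ℤ.*-identityʳ (n ℤ.* n))))
        (trans (cong ℤ.∣_∣ cross) (ℤ.abs-* (ℤ.+ 2) (ℤ.+ (suc d ℕ.* suc d)))))

module ℚ-¬DCI where
  import Data.Fin as Fin
  open import Data.Vec.Functional using (_∷_; [])
  open import Data.Rational
  open import Data.Rational.Properties
  open import Data.Rational.Solver using (module +-*-Solver)
  open +-*-Solver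
  open import Relation.Binary using (tri<; tri≈; tri>)
  open import Relation.Nullary.Decidable using (toWitness; toWitnessFalse)
  open Irrationality using (no-sqrt2)

  two : ℚ
  two = 1ℚ + 1ℚ

  0<two : 0ℚ < two
  0<two = toWitness {a? = 0ℚ <? two} tt

  0<1 : 0ℚ < 1ℚ
  0<1 = toWitness {a? = 0ℚ <? 1ℚ} tt

  1²<2 : 1ℚ * 1ℚ < two
  1²<2 = toWitness {a? = 1ℚ * 1ℚ <? two} tt

  pos-* : ∀ {a b} → 0ℚ < a → 0ℚ < b → 0ℚ < a * b
  pos-* {a} {b} 0<a 0<b = subst (_< a * b) (*-zeroˡ b) (*-monoˡ-<-pos b {{positive 0<b}} 0<a)

  sq-mono : ∀ {y z} → 0ℚ ≤ y → y < z → y * y < z * z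
  sq-mono {y} {z} 0≤y y<z =
    ≤-<-trans (*-monoˡ-≤-nonNeg y {{nonNegative 0≤y}} (<⇒≤ y<z))
              (*-monoˡ-<-pos z {{positive (≤-<-trans 0≤y y<z)}} y<z)

  trade : ∀ {a b c d} → a + b ≡ c + d → b < d → c < a
  trade {a} {b} {c} {d} a+b≡c+d b<d = subst₂ _<_ (cancel c b) (cancel a b)
    (+-monoˡ-< (- b) (subst (c + b <_) (sym a+b≡c+d) (+-monoʳ-< c b<d)))
    where
    cancel : ∀ p q → p + q - q ≡ p
    cancel = solve 2 (λ p q → p :+ q :- q := p) refl

  Φ : ℚ → Set
  Φ y = y < 0ℚ ⊎ y * y < two

  Φ-down : ∀ {y z} → y < z → Φ z → Φ y
  Φ-down {y} y<z (inj₁ z<0) = inj₁ (<-trans y<z z<0)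
  Φ-down {y} y<z (inj₂ z²<2) with y <? 0ℚ
  ... | yes y<0 = inj₁ y<0
  ... | no y≮0 = inj₂ (<-trans (sq-mono (≮⇒≥ y≮0) y<z) z²<2)

  -- the rational approximation map x ↦ (2x + 2)/(x + 2) for x > 0; it
  -- moves x towards √2 and stays on the same side of it
  module Approximation (x : ℚ) (0<x : 0ℚ < x) where
    0<x+2 : 0ℚ < x + two
    0<x+2 = <-trans 0<x (subst (_< x + two) (+-identityʳ x) (+-monoʳ-< x 0<two))

    instance
      x+2≢0 : NonZero (x + two)
      x+2≢0 = >-nonZero 0<x+2

    i : ℚ
    i = 1/ (x + two)

    instance
      i>0 : Positive i
      i>0 = 1/pos⇒pos (x + two) {{positive 0<x+2}}

    [x+2]i≡1 : (x + two) * i ≡ 1ℚ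
    [x+2]i≡1 = *-inverseʳ (x + two)

    z : ℚ
    z = (two * x + two) * i

    0<z : 0ℚ < z
    0<z = pos-* (<-trans 0<x+2 (+-monoˡ-< two x<2x)) (positive⁻¹ i)
      where
      x<2x : x < two * x
      x<2x = subst₂ _<_ (+-identityʳ x) (solve 1 (λ x → x :+ x := con two :* x) refl x)
               (+-monoʳ-< x 0<x)

    -- z - x = (2 - x²)·i
    first-order : z + x * x * i ≡ x + two * i
    first-order = begin
      z + x * x * i            ≡⟨ solve 2 (λ x i → (con two :* x :+ con two) :* i :+ x :* x :* i
                                                   := x :* ((x :+ con two) :* i) :+ con two :* i) refl x i ⟩
      x * ((x + two) * i) + two * i  ≡⟨ cong (λ u → x * u + two * i) [x+2]i≡1 ⟩
      x * 1ℚ + two * i               ≡⟨ cong (_+ two * i) (*-identityʳ x) ⟩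
      x + two * i                    ∎
      where open ≡-Reasoning

    c : ℚ
    c = two * (i * i)

    0<c : 0ℚ < c
    0<c = pos-* 0<two (pos-* (positive⁻¹ i) (positive⁻¹ i))

    -- 2 - z² = (2 - x²)·c
    second-order : z * z + two * c ≡ two + x * x * c
    second-order = begin
      z * z + two * c                ≡⟨ solve 2 (λ x i → (con two :* x :+ con two) :* i :* ((con two :* x :+ con two) :* i)
                                                         :+ con two :* (con two :* (i :* i))
                                                   := con two :* (((x :+ con two) :* i) :* ((x :+ con two) :* i))
                                                         :+ x :* x :* (con two :* (i :* i))) refl x i ⟩
      two * (((x + two) * i) * ((x + two) * i)) + x * x * c  ≡⟨ cong (λ u → two * (u * u) + x * x * c) [x+2]i≡1 ⟩
      two + x * x * c                ∎
      where open ≡-Reasoning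

    below-√2 : x * x < two → x < z × z * z < two
    below-√2 x²<2 = trade first-order (*-monoˡ-<-pos i x²<2)
                  , trade (sym second-order) (*-monoˡ-<-pos c {{positive 0<c}} x²<2)

    above-√2 : two < x * x → z < x × two < z * z
    above-√2 2<x² = trade (sym first-order) (*-monoˡ-<-pos i 2<x²)
                  , trade second-order (*-monoˡ-<-pos c {{positive 0<c}} 2<x²)

  Φ-step : ∀ x → (∀ y → y < x → Φ y) → ∃[ z ] (x < z × (∀ y → y < z → Φ y))
  Φ-step x below-x with x ≤? 0ℚ
  ... | yes x≤0 = 1ℚ , ≤-<-trans x≤0 0<1 , λ y y<1 → Φ-down y<1 (inj₂ 1²<2)
  ... | no x≰0 with <-cmp (x * x) two
  ...   | tri≈ _ x²≡2 _ = ⊥-elim (no-sqrt2 x x²≡2)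
  ...   | tri< x²<2 _ _ = z , x<z , λ y y<z → Φ-down y<z (inj₂ z²<2)
    where
    open Approximation x (≰⇒> x≰0)
    x<z : x < z
    x<z = proj₁ (below-√2 x²<2)
    z²<2 : z * z < two
    z²<2 = proj₂ (below-√2 x²<2)
  ...   | tri> _ _ 2<x² = ⊥-elim (¬Φz (below-x z (proj₁ (above-√2 2<x²))))
    where
    open Approximation x (≰⇒> x≰0)
    ¬Φz : ¬ Φ z
    ¬Φz (inj₁ z<0) = <-asym z<0 0<z
    ¬Φz (inj₂ z²<2) = <-asym z²<2 (proj₂ (above-√2 2<x²))

  φ₀ : Formula OFSig 1
  φ₀ = lt y (app zeroF []) ∨' lt (app mulF (y ∷ y ∷ [])) (app plusF (app oneF [] ∷ app oneF [] ∷ []))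
    where
    y : Term OFSig 1
    y = var Fin.zero
    lt : Term OFSig 1 → Term OFSig 1 → Formula OFSig 1
    lt s t = rel lessR (s ∷ t ∷ [])

  -- the DCI instance for φ₀ (whose satisfaction unfolds to Φ) would give Φ 2
  ¬dci-ℚ : ¬ DCI-ℚ
  ¬dci-ℚ dci = ¬Φ2 (dci φ₀ (λ ()) ((0ℚ , λ y y<0 → inj₁ y<0) , Φ-step) two)
    where
    ¬Φ2 : ¬ Φ two
    ¬Φ2 (inj₁ 2<0) = toWitnessFalse {a? = two <? 0ℚ} tt 2<0
    ¬Φ2 (inj₂ 4<2) = toWitnessFalse {a? = two * two <? two} tt 4<2

-- The theorem

theorem2p8 : ExcludedMiddle 0ℓ →
    ((E : Signature) (G : ODAG E) → DCI-ODAG G → DCI₁-ODAG G)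
    × (DCI₁-ℚ × ¬ DCI-ℚ)
theorem2p8 _ = (λ E G → DCI⇒DCI₁.dci⇒dci₁-ODAG G) , ℚ-DCI₁.dci₁-ℚ , ℚ-¬DCI.¬dci-ℚ
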